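{- Let $H$ be a graph on $m$ vertices. Then $g(H,k)\ge k/m^3$ for all sufficiently large $k$.
   Context: For a graph $H$, an edge colouring $c:E(K_n)\to[k]$ contains a rainbow copy of $H$ if some subgraph of $K_n$ isomorphic to $H$ has all its edges of pairwise distinct colours; otherwise it is rainbow $H$-free. The colouring has colour distribution sequence $(e_1,\dots,e_k)$ if exactly $e_i$ edges have colour $i$. $g(H,k)$ is the smallest integer $N$ such that for all $n\ge N$ and all non-negative integers $e_1,\dots,e_k$ with $\sum_i e_i=\binom n2$, there exists a rainbow $H$-free colouring of $K_n$ with colour distribution sequence $(e_1,\dots,e_k)$; if no such $N$ exists, $g(H,k)=\infty$. -}

module Defs where

open import Data.Nat using (ℕ; zero; suc; _+_; _*_; _^_; _≤_; _<ᵇ_)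
open import Data.Nat.Combinatorics using (_C_)
open import Data.Fin using (Fin; toℕ; _≟_)
open import Data.Bool using (Bool; true; false; if_then_else_; _∧_)
open import Data.List using (List; map; concatMap)
open import Data.Nat.ListAction using (sum)
open import Data.List using () renaming (allFin to allFinL)
open import Data.Product using (Σ; ∃; _×_; _,_)
open import Data.Sum using (_⊎_)
open import Data.Empty using (⊥)
open import Relation.Nullary using (¬_)
open import Relation.Nullary.Decidable using (isYes)
open import Relation.Binary.PropositionalEquality using (_≡_)
open import Function.Definitions using (Injective)

record Graph (m : ℕ) : Set₁ where
  field
    Adj     : Fin m → Fin m → Set
    sym     : ∀ {a b} → Adj a b → Adj b a
    irrefl  : ∀ {a} → ¬ Adj a a
open Graph public

-- An edge colouring of K_n with colours Fin k.  The colour of the edge {u,v}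
-- with toℕ u < toℕ v is  c u v ; values of c at other pairs are ignored.
Colouring : ℕ → ℕ → Set
Colouring n k = Fin n → Fin n → Fin k

edgeColour : ∀ {n k} → Colouring n k → Fin n → Fin n → Fin k
edgeColour c u v = if toℕ u <ᵇ toℕ v then c u v else c v u

colourCount : ∀ {n k} → Colouring n k → Fin k → ℕ
colourCount {n} c i =
  sum (concatMap (λ u → map (λ v →
        if (toℕ u <ᵇ toℕ v) ∧ isYes (c u v ≟ i) then 1 else 0)
      (allFinL n)) (allFinL n))

total : ∀ {k} → (Fin k → ℕ) → ℕ
total {k} e = sum (map e (allFinL k))

HasDistribution : ∀ {n k} → Colouring n k → (Fin k → ℕ) → Set
HasDistribution c e = ∀ i → colourCount c i ≡ e i

IsRainbowCopy : ∀ {m n k} → Graph m → Colouring n k → (Fin m → Fin n) → Set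
IsRainbowCopy H c φ =
  Injective _≡_ _≡_ φ ×
  (∀ a b a′ b′ → Adj H a b → Adj H a′ b′ →
     edgeColour c (φ a) (φ b) ≡ edgeColour c (φ a′) (φ b′) →
     (a ≡ a′ × b ≡ b′) ⊎ (a ≡ b′ × b ≡ a′))

RainbowFree : ∀ {m n k} → Graph m → Colouring n k → Set
RainbowFree H c = ¬ (∃ λ φ → IsRainbowCopy H c φ)

-- N has the defining property of g(H,k): for all n ≥ N and all distribution
-- sequences summing to (n choose 2) there is a rainbow H-free colouring of K_n
-- with that distribution.  g(H,k) is the least such N (∞ if none).
GoodThreshold : ∀ {m} → Graph m → (k N : ℕ) → Set
GoodThreshold H k N =
  ∀ n → N ≤ n → (e : Fin k → ℕ) → total e ≡ n C 2 →
  Σ (Colouring n k) λ c → RainbowFree H c × HasDistribution c e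

-- Colour K_n with k > m³ n colours as evenly as possible: every colour class has at most
-- q + 1 edges with 2 m³ q ≤ n, so every vertex sees each colour at most q + 2 times. Such a
-- colouring contains a rainbow K_m, built greedily: v extends a rainbow set X unless v ∈ X, an
-- edge from v to X repeats a colour of X, or two edges from v to X share a colour. The first two
-- kinds of conflict exclude few vertices by a degree count; the third is controlled by the
-- potential Φ X = Σ_{x,y ∈ X} #{w : wx and wy have the same colour}, which choosing v by a
-- weighted averaging keeps below |X|² (q + 2). So a rainbow-free colouring of K_n with the
-- balanced distribution exists only if k ≤ m³ n.

module Submission where

open import Data.Bool using (true; false; if_then_else_; _∧_; T)
open import Data.Bool.Properties using (T-≡)
open import Data.Fin using (Fin; zero; suc; toℕ; _≟_; punchIn)
open import Data.Fin.Properties using (toℕ-injective; punchInᵢ≢i)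
open import Data.List using (List; []; _∷_; map; _++_; length; lookup; concatMap; tabulate; allFin)
open import Data.List.Membership.Propositional using (_∈_; _∉_)
open import Data.List.Membership.Propositional.Properties
  using (∈-map⁺; ∈-map⁻; ∈-++⁺ˡ; ∈-++⁺ʳ; ∈-++⁻; ∈-lookup)
open import Data.List.Properties using (map-tabulate; length-map; length-++)
open import Data.List.Relation.Unary.All as All using ()
open import Data.List.Relation.Unary.All.Properties using (¬Any⇒All¬)
open import Data.List.Relation.Unary.AllPairs using ([]; _∷_)
open import Data.List.Relation.Unary.Any using (here; there)
open import Data.List.Relation.Unary.Unique.Propositional using (Unique)
open import Data.Nat hiding (_≟_)
open import Data.Nat.Combinatorics using (_C_; nC1≡n; nCk+nC[k+1]≡[n+1]C[k+1])
open import Data.Nat.DivMod using (_/_; _%_; m≡m%n+[m/n]*n; m%n≤n; m/n*n≤m)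
open import Data.Nat.ListAction using (sum)
open import Data.Nat.ListAction.Properties using (sum-++)
open import Data.Nat.Properties hiding (_≟_)
open import Data.Nat.Tactic.RingSolver using (solve)
open import Data.Product as Product using (∃; _×_; _,_; proj₁; proj₂)
open import Data.Sum as Sum using (_⊎_; inj₁; inj₂)
open import Defs hiding (sym)
open import Function using (_∘_; id; Equivalence)
open import Relation.Binary.Definitions using (tri<; tri≈; tri>)
open import Relation.Binary.PropositionalEquality
open import Relation.Nullary using (¬_; Dec; yes; no; contradiction)
open import Relation.Nullary.Decidable using (isYes)

open import Algebra.Properties.CommutativeSemigroup *-commutativeSemigroup using (x∙yz≈y∙xz)
open import Algebra.Properties.Semiring.Sum +-*-semiring
  using (sum-syntax; ∑-distrib-+; ∑-comm; sum-remove; sum-cong-≗; *-distribˡ-sum)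
  renaming (sum to ∑)

𝟙 : ∀ {P : Set} → Dec P → ℕ
𝟙 d = if isYes d then 1 else 0

𝟙≤1 : ∀ {P : Set} (d : Dec P) → 𝟙 d ≤ 1
𝟙≤1 (yes _) = ≤-refl
𝟙≤1 (no _) = z≤n

𝟙-yes : ∀ {P : Set} (d : Dec P) → P → 𝟙 d ≡ 1
𝟙-yes (yes _) _ = refl
𝟙-yes (no ¬p) p = contradiction p ¬p

𝟙-no : ∀ {P : Set} (d : Dec P) → ¬ P → 𝟙 d ≡ 0
𝟙-no (yes p) ¬p = contradiction p ¬p
𝟙-no (no _) _ = refl

𝟙≡0⇒¬ : ∀ {P : Set} (d : Dec P) → 𝟙 d ≡ 0 → ¬ P
𝟙≡0⇒¬ (no ¬p) _ = ¬p

∑-mono-≤ : ∀ {n} {f g : Fin n → ℕ} → (∀ i → f i ≤ g i) → ∑ f ≤ ∑ g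
∑-mono-≤ {zero} _ = z≤n
∑-mono-≤ {suc n} f≤g = +-mono-≤ (f≤g zero) (∑-mono-≤ (f≤g ∘ suc))

∑-const : ∀ n a → ∑[ i < n ] a ≡ n * a
∑-const zero a = refl
∑-const (suc n) a = cong (a +_) (∑-const n a)

f≤∑f : ∀ {n} (f : Fin n → ℕ) i → f i ≤ ∑ f
f≤∑f {suc n} f i = ≤-trans (m≤m+n (f i) _) (≤-reflexive (sym (sum-remove {i = i} f)))

∑-𝟙[v≟w]≡1 : ∀ {n} (w : Fin n) → ∑[ v < n ] 𝟙 (v ≟ w) ≡ 1
∑-𝟙[v≟w]≡1 {suc n} w = begin
  ∑[ v < suc n ] 𝟙 (v ≟ w)                     ≡⟨ sum-remove {i = w} (λ v → 𝟙 (v ≟ w)) ⟩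
  𝟙 (w ≟ w) + ∑[ v < n ] 𝟙 (punchIn w v ≟ w)  ≡⟨ cong₂ _+_ (𝟙-yes (w ≟ w) refl) (sum-cong-≗ λ v → 𝟙-no (punchIn w v ≟ w) (punchInᵢ≢i w v)) ⟩
  1 + ∑[ v < n ] 0                             ≡⟨ cong suc (trans (∑-const n 0) (*-zeroʳ n)) ⟩
  1                                            ∎
  where open ≡-Reasoning

row+column≤∑∑ : ∀ {n} (a : Fin n → Fin n → ℕ) w → a w w ≡ 0 →
  ∑ (a w) + ∑[ u < n ] a u w ≤ ∑[ u < n ] ∑ (a u)
row+column≤∑∑ {suc n} a w aww≡0 = begin
  ∑ (a w) + ∑[ u < suc n ] a u w                    ≡⟨ cong (∑ (a w) +_) (sum-remove {i = w} (λ u → a u w)) ⟩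
  ∑ (a w) + (a w w + ∑[ u < n ] a (punchIn w u) w)  ≡⟨ cong (λ t → ∑ (a w) + (t + ∑[ u < n ] a (punchIn w u) w)) aww≡0 ⟩
  ∑ (a w) + ∑[ u < n ] a (punchIn w u) w            ≤⟨ +-monoʳ-≤ (∑ (a w)) (∑-mono-≤ λ u → f≤∑f (a (punchIn w u)) w) ⟩
  ∑ (a w) + ∑[ u < n ] ∑ (a (punchIn w u))          ≡⟨ sum-remove {i = w} (λ u → ∑ (a u)) ⟨
  ∑[ u < suc n ] ∑ (a u)                             ∎
  where open ≤-Reasoning

listSum : ∀ {A : Set} → List A → (A → ℕ) → ℕ
listSum xs f = ∑[ i < length xs ] f (lookup xs i)

infixl 10 listSum
syntax listSum xs (λ x → e) = ∑[ x ← xs ] e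

listSum-++ : ∀ {A : Set} (xs ys : List A) (f : A → ℕ) → listSum (xs ++ ys) f ≡ listSum xs f + listSum ys f
listSum-++ [] ys f = refl
listSum-++ (x ∷ xs) ys f = trans (cong (f x +_) (listSum-++ xs ys f)) (sym (+-assoc (f x) _ _))

listSum-map : ∀ {A B : Set} (g : A → B) (xs : List A) (f : B → ℕ) → listSum (map g xs) f ≡ listSum xs (f ∘ g)
listSum-map g [] f = refl
listSum-map g (x ∷ xs) f = cong (f (g x) +_) (listSum-map g xs f)

listSum≡0 : ∀ {A : Set} {xs : List A} (f : A → ℕ) → listSum xs f ≡ 0 → ∀ {x} → x ∈ xs → f x ≡ 0
listSum≡0 {xs = y ∷ _} f ∑≡0 (here refl) = m+n≡0⇒m≡0 (f y) ∑≡0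
listSum≡0 {xs = y ∷ _} f ∑≡0 (there x∈) = listSum≡0 f (m+n≡0⇒n≡0 (f y) ∑≡0) x∈

listSum-cong : ∀ {A : Set} (xs : List A) {f g : A → ℕ} → (∀ x → f x ≡ g x) → listSum xs f ≡ listSum xs g
listSum-cong xs f≗g = sum-cong-≗ (f≗g ∘ lookup xs)

listSum-mono-≤ : ∀ {A : Set} (xs : List A) {f g : A → ℕ} → (∀ x → f x ≤ g x) → listSum xs f ≤ listSum xs g
listSum-mono-≤ xs f≤g = ∑-mono-≤ (f≤g ∘ lookup xs)

listSum-const : ∀ {A : Set} (xs : List A) a → ∑[ x ← xs ] a ≡ length xs * a
listSum-const xs a = ∑-const (length xs) a

∑-listSum-comm : ∀ {A : Set} {n} (xs : List A) (f : Fin n → A → ℕ) →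
  ∑[ v < n ] ∑[ x ← xs ] f v x ≡ ∑[ x ← xs ] ∑[ v < n ] f v x
∑-listSum-comm xs f = ∑-comm (λ v i → f v (lookup xs i))

sum-tabulate : ∀ {n} (f : Fin n → ℕ) → sum (tabulate f) ≡ ∑ f
sum-tabulate {zero} f = refl
sum-tabulate {suc n} f = cong (f zero +_) (sum-tabulate (f ∘ suc))

sum-map-allFin : ∀ {n} (f : Fin n → ℕ) → sum (map f (allFin n)) ≡ ∑ f
sum-map-allFin f = trans (cong sum (map-tabulate id f)) (sum-tabulate f)

sum-concatMap : ∀ {A : Set} (g : A → List ℕ) (xs : List A) → sum (concatMap g xs) ≡ sum (map (sum ∘ g) xs)
sum-concatMap g [] = refl
sum-concatMap g (x ∷ xs) = trans (sum-++ (g x) _) (cong (sum (g x) +_) (sum-concatMap g xs))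

<ᵇ≡true : ∀ {m n} → m < n → (m <ᵇ n) ≡ true
<ᵇ≡true m<n = Equivalence.to T-≡ (<⇒<ᵇ m<n)

<ᵇ≡false : ∀ {m n} → n ≤ m → (m <ᵇ n) ≡ false
<ᵇ≡false {m} {n} n≤m with m <ᵇ n in eq
... | false = refl
... | true = contradiction (<ᵇ⇒< m n (subst T (sym eq) _)) (≤⇒≯ n≤m)

module _ {n k} (c : Colouring n k) where

  edgeColour-< : ∀ {u v} → toℕ u < toℕ v → edgeColour c u v ≡ c u v
  edgeColour-< u<v rewrite <ᵇ≡true u<v = refl

  edgeColour-> : ∀ {u v} → toℕ v < toℕ u → edgeColour c u v ≡ c v u
  edgeColour-> v<u rewrite <ᵇ≡false (<⇒≤ v<u) = refl

  edgeColour-comm : ∀ u v → edgeColour c u v ≡ edgeColour c v u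
  edgeColour-comm u v with <-cmp (toℕ u) (toℕ v)
  ... | tri< u<v _ _ = trans (edgeColour-< u<v) (sym (edgeColour-> u<v))
  ... | tri≈ _ u≡v _ rewrite toℕ-injective u≡v = refl
  ... | tri> _ _ v<u = trans (edgeColour-> v<u) (sym (edgeColour-< v<u))

  upperEdge : Fin k → Fin n → Fin n → ℕ
  upperEdge i u v = if (toℕ u <ᵇ toℕ v) ∧ isYes (c u v ≟ i) then 1 else 0

  colourCount≡∑upperEdge : ∀ i → colourCount c i ≡ ∑[ u < n ] ∑[ v < n ] upperEdge i u v
  colourCount≡∑upperEdge i = begin
    colourCount c i                                         ≡⟨ sum-concatMap (λ u → map (upperEdge i u) (allFin n)) (allFin n) ⟩
    sum (map (λ u → sum (map (upperEdge i u) (allFin n))) (allFin n))  ≡⟨ sum-map-allFin (λ u → sum (map (upperEdge i u) (allFin n))) ⟩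
    ∑[ u < n ] sum (map (upperEdge i u) (allFin n))        ≡⟨ sum-cong-≗ (λ u → sum-map-allFin (upperEdge i u)) ⟩
    ∑[ u < n ] ∑[ v < n ] upperEdge i u v                   ∎
    where open ≡-Reasoning

  upperEdge-< : ∀ i {u v} → toℕ u < toℕ v → upperEdge i u v ≡ 𝟙 (c u v ≟ i)
  upperEdge-< i u<v rewrite <ᵇ≡true u<v = refl

  upperEdge-diag : ∀ i u → upperEdge i u u ≡ 0
  upperEdge-diag i u rewrite <ᵇ≡false (≤-refl {toℕ u}) = refl

  colourDegree : Fin n → Fin k → ℕ
  colourDegree w i = ∑[ v < n ] 𝟙 (edgeColour c w v ≟ i)

  -- The term 𝟙 (v ≟ w) pays for the loop at w, whose colour c w w is not an edge colour.
  𝟙-edgeColour≤ : ∀ i w v → 𝟙 (edgeColour c w v ≟ i) ≤ upperEdge i w v + upperEdge i v w + 𝟙 (v ≟ w)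
  𝟙-edgeColour≤ i w v with <-cmp (toℕ w) (toℕ v)
  ... | tri< w<v _ _ = begin
    𝟙 (edgeColour c w v ≟ i) ≡⟨ cong (λ col → 𝟙 (col ≟ i)) (edgeColour-< w<v) ⟩
    𝟙 (c w v ≟ i)            ≡⟨ upperEdge-< i w<v ⟨
    upperEdge i w v          ≤⟨ m≤m+n _ _ ⟩
    upperEdge i w v + upperEdge i v w               ≤⟨ m≤m+n _ _ ⟩
    upperEdge i w v + upperEdge i v w + 𝟙 (v ≟ w) ∎
    where open ≤-Reasoning
  ... | tri≈ _ w≡v _ = begin
    𝟙 (edgeColour c w v ≟ i) ≤⟨ 𝟙≤1 _ ⟩
    1                        ≡⟨ 𝟙-yes (v ≟ w) (sym (toℕ-injective w≡v)) ⟨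
    𝟙 (v ≟ w)                ≤⟨ m≤n+m _ _ ⟩
    upperEdge i w v + upperEdge i v w + 𝟙 (v ≟ w) ∎
    where open ≤-Reasoning
  ... | tri> _ _ v<w = begin
    𝟙 (edgeColour c w v ≟ i) ≡⟨ cong (λ col → 𝟙 (col ≟ i)) (edgeColour-> v<w) ⟩
    𝟙 (c v w ≟ i)            ≡⟨ upperEdge-< i v<w ⟨
    upperEdge i v w          ≤⟨ m≤n+m _ _ ⟩
    upperEdge i w v + upperEdge i v w               ≤⟨ m≤m+n _ _ ⟩
    upperEdge i w v + upperEdge i v w + 𝟙 (v ≟ w) ∎
    where open ≤-Reasoning

  colourDegree≤colourCount+1 : ∀ w i → colourDegree w i ≤ colourCount c i + 1
  colourDegree≤colourCount+1 w i = begin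
    ∑[ v < n ] 𝟙 (edgeColour c w v ≟ i)                                    ≤⟨ ∑-mono-≤ (𝟙-edgeColour≤ i w) ⟩
    ∑[ v < n ] (upperEdge i w v + upperEdge i v w + 𝟙 (v ≟ w))             ≡⟨ ∑-distrib-+ (λ v → upperEdge i w v + upperEdge i v w) _ ⟩
    ∑[ v < n ] (upperEdge i w v + upperEdge i v w) + ∑[ v < n ] 𝟙 (v ≟ w)  ≡⟨ cong₂ _+_ (∑-distrib-+ (upperEdge i w) _) (∑-𝟙[v≟w]≡1 w) ⟩
    ∑ (upperEdge i w) + ∑[ v < n ] upperEdge i v w + 1                    ≤⟨ +-monoˡ-≤ 1 (row+column≤∑∑ (upperEdge i) w (upperEdge-diag i w)) ⟩
    ∑[ u < n ] ∑ (upperEdge i u) + 1                                       ≡⟨ cong (_+ 1) (colourCount≡∑upperEdge i) ⟨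
    colourCount c i + 1                                                    ∎
    where open ≤-Reasoning

[1+n]C2≡n+nC2 : ∀ n → suc n C 2 ≡ n + n C 2
[1+n]C2≡n+nC2 n = trans (sym (nCk+nC[k+1]≡[n+1]C[k+1] n 1)) (cong (_+ n C 2) (nC1≡n n))

2*nC2≤n*n : ∀ n → 2 * (n C 2) ≤ n * n
2*nC2≤n*n zero = z≤n
2*nC2≤n*n (suc n) = begin
  2 * (suc n C 2)        ≡⟨ cong (2 *_) ([1+n]C2≡n+nC2 n) ⟩
  2 * (n + n C 2)        ≡⟨ *-distribˡ-+ 2 n (n C 2) ⟩
  2 * n + 2 * (n C 2)    ≤⟨ +-monoʳ-≤ (2 * n) (2*nC2≤n*n n) ⟩
  2 * n + n * n          ≤⟨ n≤1+n _ ⟩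
  1 + (2 * n + n * n)    ≡⟨ solve (n ∷ []) ⟩
  suc n * suc n          ∎
  where open ≤-Reasoning

pairs : ∀ {A : Set} → List A → List (A × A)
pairs [] = []
pairs (x ∷ xs) = map (x ,_) xs ++ pairs xs

length-pairs : ∀ {A : Set} (xs : List A) → length (pairs xs) ≡ length xs C 2
length-pairs [] = refl
length-pairs (x ∷ xs) = begin
  length (map (x ,_) xs ++ pairs xs)          ≡⟨ length-++ (map (x ,_) xs) ⟩
  length (map (x ,_) xs) + length (pairs xs)  ≡⟨ cong₂ _+_ (length-map (x ,_) xs) (length-pairs xs) ⟩
  length xs + length xs C 2                   ≡⟨ [1+n]C2≡n+nC2 (length xs) ⟨
  suc (length xs) C 2                         ∎
  where open ≡-Reasoning

∈-pairs : ∀ {A : Set} {xs : List A} {x y} → x ∈ xs → y ∈ xs → x ≢ y → (x , y) ∈ pairs xs ⊎ (y , x) ∈ pairs xs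
∈-pairs (here refl) (here refl) x≢y = contradiction refl x≢y
∈-pairs {xs = x ∷ xs} (here refl) (there y∈) _ = inj₁ (∈-++⁺ˡ (∈-map⁺ (x ,_) y∈))
∈-pairs {xs = y ∷ xs} (there x∈) (here refl) _ = inj₂ (∈-++⁺ˡ (∈-map⁺ (y ,_) x∈))
∈-pairs {xs = z ∷ xs} (there x∈) (there y∈) x≢y with ∈-pairs x∈ y∈ x≢y
... | inj₁ xy∈ = inj₁ (∈-++⁺ʳ (map (z ,_) xs) xy∈)
... | inj₂ yx∈ = inj₂ (∈-++⁺ʳ (map (z ,_) xs) yx∈)

lookup-injective : ∀ {A : Set} {xs : List A} → Unique xs → ∀ {i j} → lookup xs i ≡ lookup xs j → i ≡ j
lookup-injective (_ ∷ _) {zero} {zero} _ = refl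
lookup-injective (x∉xs ∷ _) {zero} {suc j} x≡xⱼ = contradiction x≡xⱼ (All.lookup x∉xs (∈-lookup j))
lookup-injective (x∉xs ∷ _) {suc i} {zero} xᵢ≡x = contradiction (sym xᵢ≡x) (All.lookup x∉xs (∈-lookup i))
lookup-injective (_ ∷ xs!) {suc i} {suc j} xᵢ≡xⱼ = cong suc (lookup-injective xs! xᵢ≡xⱼ)

module _ {n k} (c : Colouring n k) where

  pairColour : Fin n × Fin n → Fin k
  pairColour (u , v) = edgeColour c u v

  Rainbow : List (Fin n) → Set
  Rainbow X = Unique X × (∀ {p p′} → p ∈ pairs X → p′ ∈ pairs X → pairColour p ≡ pairColour p′ → p ≡ p′)

  rainbow-[] : Rainbow []
  rainbow-[] = [] , λ ()

  rainbow-∷ : ∀ {v X} → Rainbow X → v ∉ X →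
    (∀ {x p} → x ∈ X → p ∈ pairs X → edgeColour c v x ≢ pairColour p) →
    (∀ {x y} → (x , y) ∈ pairs X → edgeColour c v x ≢ edgeColour c v y) →
    Rainbow (v ∷ X)
  rainbow-∷ {v} {X} (X! , inj) v∉X oldColour newColour = ¬Any⇒All¬ X v∉X ∷ X! , inj′
    where
    sameEnd : ∀ {x y} → x ∈ X → y ∈ X → edgeColour c v x ≡ edgeColour c v y → x ≡ y
    sameEnd {x} {y} x∈X y∈X eq with x ≟ y
    ... | yes x≡y = x≡y
    ... | no x≢y with ∈-pairs x∈X y∈X x≢y
    ...   | inj₁ xy∈ = contradiction eq (newColour xy∈)
    ...   | inj₂ yx∈ = contradiction (sym eq) (newColour yx∈)

    inj′ : ∀ {p p′} → p ∈ pairs (v ∷ X) → p′ ∈ pairs (v ∷ X) → pairColour p ≡ pairColour p′ → p ≡ p′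
    inj′ p∈ p′∈ eq with ∈-++⁻ (map (v ,_) X) p∈ | ∈-++⁻ (map (v ,_) X) p′∈
    ... | inj₁ vx∈ | inj₁ vy∈ with ∈-map⁻ (v ,_) vx∈ | ∈-map⁻ (v ,_) vy∈
    ...   | _ , x∈X , refl | _ , y∈X , refl = cong (v ,_) (sameEnd x∈X y∈X eq)
    inj′ p∈ p′∈ eq | inj₁ vx∈ | inj₂ p′∈X with ∈-map⁻ (v ,_) vx∈
    ...   | _ , x∈X , refl = contradiction eq (oldColour x∈X p′∈X)
    inj′ p∈ p′∈ eq | inj₂ p∈X | inj₁ vy∈ with ∈-map⁻ (v ,_) vy∈
    ...   | _ , y∈X , refl = contradiction (sym eq) (oldColour y∈X p∈X)
    inj′ p∈ p′∈ eq | inj₂ p∈X | inj₂ p′∈X = inj p∈X p′∈X eq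

  pairOf : ∀ {X a b} → a ∈ X → b ∈ X → a ≢ b →
    ∃ λ p → p ∈ pairs X × pairColour p ≡ edgeColour c a b × (p ≡ (a , b) ⊎ p ≡ (b , a))
  pairOf {a = a} {b} a∈X b∈X a≢b with ∈-pairs a∈X b∈X a≢b
  ... | inj₁ ab∈ = (a , b) , ab∈ , refl , inj₁ refl
  ... | inj₂ ba∈ = (b , a) , ba∈ , edgeColour-comm c b a , inj₂ refl

  rainbow-edgeColour-injective : ∀ {X a b a′ b′} → Rainbow X →
    a ∈ X → b ∈ X → a′ ∈ X → b′ ∈ X → a ≢ b → a′ ≢ b′ →
    edgeColour c a b ≡ edgeColour c a′ b′ → (a ≡ a′ × b ≡ b′) ⊎ (a ≡ b′ × b ≡ a′)
  rainbow-edgeColour-injective (_ , inj) a∈X b∈X a′∈X b′∈X a≢b a′≢b′ eq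
    with pairOf a∈X b∈X a≢b | pairOf a′∈X b′∈X a′≢b′
  ... | p , p∈ , colour≡ , orientation | p′ , p′∈ , colour′≡ , orientation′
    with inj p∈ p′∈ (trans colour≡ (trans eq (sym colour′≡)))
  ... | refl with orientation | orientation′
  ...   | inj₁ refl | inj₁ refl = inj₁ (refl , refl)
  ...   | inj₁ refl | inj₂ refl = inj₂ (refl , refl)
  ...   | inj₂ refl | inj₁ refl = inj₂ (refl , refl)
  ...   | inj₂ refl | inj₂ refl = inj₁ (refl , refl)

  rainbowCopy : ∀ {m} (H : Graph m) {X} → Rainbow X → length X ≡ m → ∃ λ φ → IsRainbowCopy H c φ
  rainbowCopy H {X} rainbow@(X! , _) refl = lookup X , lookup-injective X! , rainbowEdges
    where
    distinctEnds : ∀ {a b} → Adj H a b → lookup X a ≢ lookup X b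
    distinctEnds ab xₐ≡x_b = irrefl H (subst (Adj H _) (sym (lookup-injective X! xₐ≡x_b)) ab)

    rainbowEdges : ∀ a b a′ b′ → Adj H a b → Adj H a′ b′ →
      edgeColour c (lookup X a) (lookup X b) ≡ edgeColour c (lookup X a′) (lookup X b′) →
      (a ≡ a′ × b ≡ b′) ⊎ (a ≡ b′ × b ≡ a′)
    rainbowEdges a b a′ b′ ab a′b′ eq =
      Sum.map (Product.map lookup-injective′ lookup-injective′) (Product.map lookup-injective′ lookup-injective′)
        (rainbow-edgeColour-injective rainbow (∈-lookup a) (∈-lookup b) (∈-lookup a′) (∈-lookup b′)
          (distinctEnds ab) (distinctEnds a′b′) eq)
      where
      lookup-injective′ : ∀ {i j} → lookup X i ≡ lookup X j → i ≡ j
      lookup-injective′ = lookup-injective X!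

∃-term<average : ∀ {n} (f : Fin n → ℕ) M → ∑ f < n * M → ∃ λ v → f v < M
∃-term<average {suc n} f M ∑f<n*M with f zero <? M
... | yes f₀<M = zero , f₀<M
... | no f₀≮M = Product.map suc id (∃-term<average (f ∘ suc) M (+-cancelˡ-< M _ _ (begin-strict
  M + ∑ (f ∘ suc)       ≤⟨ +-monoˡ-≤ _ (≮⇒≥ f₀≮M) ⟩
  f zero + ∑ (f ∘ suc)  <⟨ ∑f<n*M ⟩
  M + n * M             ∎)))
  where open ≤-Reasoning

weighted-average-bound : ∀ n B s t → .{{NonZero n}} → 2 * s ≤ n → t ≤ n * B →
  suc (2 * B) * s + t < n * suc (2 * B)
weighted-average-bound n B s t 2s≤n t≤nB = *-cancelˡ-< 2 (suc (2 * B) * s + t) (n * suc (2 * B)) (begin-strict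
  2 * (suc (2 * B) * s + t)          ≡⟨ solve (B ∷ s ∷ t ∷ []) ⟩
  suc (2 * B) * (2 * s) + 2 * t      ≤⟨ +-mono-≤ (*-monoʳ-≤ (suc (2 * B)) 2s≤n) (*-monoʳ-≤ 2 t≤nB) ⟩
  suc (2 * B) * n + 2 * (n * B)      ≡⟨ solve (B ∷ n ∷ []) ⟩
  suc (2 * B) * n + n * (2 * B)      <⟨ +-monoʳ-< (suc (2 * B) * n) (*-monoʳ-< n (n<1+n (2 * B))) ⟩
  suc (2 * B) * n + n * suc (2 * B)  ≡⟨ solve (B ∷ n ∷ []) ⟩
  2 * (n * suc (2 * B))              ∎)
  where open ≤-Reasoning

m*n+o<m⇒n≡0∧o<m : ∀ m n o → m * n + o < m → n ≡ 0 × o < m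
m*n+o<m⇒n≡0∧o<m m zero o lt = refl , subst (_< m) (cong (_+ o) (*-zeroʳ m)) lt
m*n+o<m⇒n≡0∧o<m m (suc n) o lt = contradiction lt (≤⇒≯ (≤-trans (m≤m*n m (suc n)) (m≤m+n _ o)))

-- Weighting b by 1 + 2B, the weighted sum is below n (1 + 2B), so some weighted term is below 1 + 2B.
weighted-pigeonhole : ∀ {n} .{{_ : NonZero n}} (b P : Fin n → ℕ) B →
  2 * ∑ b ≤ n → ∑ P ≤ n * B → ∃ λ v → b v ≡ 0 × P v ≤ 2 * B
weighted-pigeonhole {n} b P B 2∑b≤n ∑P≤nB =
  Product.map₂ (Product.map₂ ≤-pred ∘ m*n+o<m⇒n≡0∧o<m M _ _) (∃-term<average weighted M weighted<nM)
  where
  M = suc (2 * B)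
  weighted : Fin n → ℕ
  weighted v = M * b v + P v
  weighted<nM : ∑ weighted < n * M
  weighted<nM = subst (_< n * M)
    (sym (trans (∑-distrib-+ (λ v → M * b v) P) (cong (_+ ∑ P) (sym (*-distribˡ-sum M b)))))
    (weighted-average-bound n B (∑ b) (∑ P) 2∑b≤n ∑P≤nB)

cube-bound : ∀ {j m} → suc j ≤ m → j * j * (j + 2) ≤ m ^ 3
cube-bound {j} {m} j<m = begin
  j * j * (j + 2)                        ≤⟨ m≤m+n _ (j * j + 3 * j + 1) ⟩
  j * j * (j + 2) + (j * j + 3 * j + 1)  ≡⟨ solve (j ∷ []) ⟩
  suc j * (suc j * (suc j * 1))          ≤⟨ ^-monoˡ-≤ 3 j<m ⟩
  m ^ 3                                  ∎
  where open ≤-Reasoning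

conflict-budget : ∀ {j m C n} S → suc j ≤ m → 2 * C ≤ j * j → 2 * m + m ^ 3 * S ≤ n →
  2 * (j + j * (C * S) + j * j * S) ≤ n
conflict-budget {j} {m} {C} {n} S j<m 2C≤j² large = begin
  2 * (j + j * (C * S) + j * j * S)             ≡⟨ solve (j ∷ C ∷ S ∷ []) ⟩
  2 * j + j * (2 * C) * S + 2 * (j * j) * S     ≤⟨ +-monoˡ-≤ _ (+-monoʳ-≤ (2 * j) (*-monoˡ-≤ S (*-monoʳ-≤ j 2C≤j²))) ⟩
  2 * j + j * (j * j) * S + 2 * (j * j) * S     ≡⟨ solve (j ∷ S ∷ []) ⟩
  2 * j + j * j * (j + 2) * S                   ≤⟨ +-mono-≤ (*-monoʳ-≤ 2 (<⇒≤ j<m)) (*-monoˡ-≤ S (cube-bound j<m)) ⟩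
  2 * m + m ^ 3 * S                             ≤⟨ large ⟩
  n                                             ∎
  where open ≤-Reasoning

potential-step : ∀ {j S P Φ} → P ≤ 2 * (j * S) → Φ ≤ j * j * S → P + Φ ≤ suc j * suc j * S
potential-step {j} {S} {P} {Φ} P≤ Φ≤ = begin
  P + Φ                          ≤⟨ +-mono-≤ P≤ Φ≤ ⟩
  2 * (j * S) + j * j * S        ≤⟨ m≤n+m _ S ⟩
  S + (2 * (j * S) + j * j * S)  ≡⟨ solve (j ∷ S ∷ []) ⟩
  suc j * suc j * S              ∎
  where open ≤-Reasoning

size-bound : ∀ {m M q n} → 2 * (M * q) ≤ n → 4 * m + 4 * M ≤ n → 2 * m + M * (q + 2) ≤ n
size-bound {m} {M} {q} {n} 2Mq≤n 4m+4M≤n = *-cancelˡ-≤ 2 (begin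
  2 * (2 * m + M * (q + 2))        ≡⟨ solve (m ∷ M ∷ q ∷ []) ⟩
  (4 * m + 4 * M) + 2 * (M * q)    ≤⟨ +-mono-≤ 4m+4M≤n 2Mq≤n ⟩
  n + n                            ≡⟨ solve (n ∷ []) ⟩
  2 * n                            ∎)
  where open ≤-Reasoning

quotient-bound : ∀ {M n k T} q .{{_ : NonZero n}} → q * k ≤ T → 2 * T ≤ n * n → M * n < k → 2 * (M * q) ≤ n
quotient-bound {M} {n} {k} {T} q qk≤T 2T≤n² Mn<k = *-cancelʳ-≤ (2 * (M * q)) n n (begin
  2 * (M * q) * n    ≡⟨ solve (M ∷ q ∷ n ∷ []) ⟩
  2 * (q * (M * n))  ≤⟨ *-monoʳ-≤ 2 (*-monoʳ-≤ q (<⇒≤ Mn<k)) ⟩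
  2 * (q * k)        ≤⟨ *-monoʳ-≤ 2 qk≤T ⟩
  2 * T              ≤⟨ 2T≤n² ⟩
  n * n              ∎)
  where open ≤-Reasoning

module Greedy {n k} (c : Colouring n k) (S : ℕ) (colourDegree≤S : ∀ w i → colourDegree c w i ≤ S) where

  colourDegreeᵀ≤S : ∀ w i → ∑[ v < n ] 𝟙 (edgeColour c v w ≟ i) ≤ S
  colourDegreeᵀ≤S w i = ≤-trans
    (≤-reflexive (sum-cong-≗ λ v → cong (λ col → 𝟙 (col ≟ i)) (edgeColour-comm c v w)))
    (colourDegree≤S w i)

  codegree : Fin n → Fin n → ℕ
  codegree x y = ∑[ w < n ] 𝟙 (edgeColour c w x ≟ edgeColour c w y)

  pairCodegree : Fin n × Fin n → ℕ
  pairCodegree (x , y) = codegree x y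

  Φ : List (Fin n) → ℕ
  Φ X = listSum (pairs X) pairCodegree

  codegreeTo : List (Fin n) → Fin n → ℕ
  codegreeTo X v = ∑[ x ← X ] codegree v x

  Φ-∷ : ∀ v X → Φ (v ∷ X) ≡ codegreeTo X v + Φ X
  Φ-∷ v X = trans (listSum-++ (map (v ,_) X) (pairs X) pairCodegree)
                  (cong (_+ Φ X) (listSum-map (v ,_) X pairCodegree))

  oldColourClash : Fin n → Fin n → Fin n × Fin n → ℕ
  oldColourClash v x p = 𝟙 (edgeColour c v x ≟ pairColour c p)

  newColourClash : Fin n → Fin n × Fin n → ℕ
  newColourClash v (x , y) = 𝟙 (edgeColour c v x ≟ edgeColour c v y)

  repeats oldColourClashes newColourClashes conflicts : List (Fin n) → Fin n → ℕ
  repeats X v = ∑[ x ← X ] 𝟙 (v ≟ x)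
  oldColourClashes X v = ∑[ x ← X ] listSum (pairs X) (oldColourClash v x)
  newColourClashes X v = listSum (pairs X) (newColourClash v)
  conflicts X v = repeats X v + oldColourClashes X v + newColourClashes X v

  conflicts≡0⇒rainbow-∷ : ∀ {X v} → Rainbow c X → conflicts X v ≡ 0 → Rainbow c (v ∷ X)
  conflicts≡0⇒rainbow-∷ {X} {v} rainbow none = rainbow-∷ c rainbow v∉X oldColour newColour
    where
    noRepeats : repeats X v ≡ 0
    noRepeats = m+n≡0⇒m≡0 _ (m+n≡0⇒m≡0 _ none)
    noOld : oldColourClashes X v ≡ 0
    noOld = m+n≡0⇒n≡0 (repeats X v) (m+n≡0⇒m≡0 _ none)
    noNew : newColourClashes X v ≡ 0
    noNew = m+n≡0⇒n≡0 (repeats X v + oldColourClashes X v) none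

    v∉X : v ∉ X
    v∉X v∈X = 𝟙≡0⇒¬ (v ≟ v) (listSum≡0 (λ x → 𝟙 (v ≟ x)) noRepeats v∈X) refl

    oldColour : ∀ {x p} → x ∈ X → p ∈ pairs X → edgeColour c v x ≢ pairColour c p
    oldColour {x} {p} x∈X p∈ = 𝟙≡0⇒¬ (edgeColour c v x ≟ pairColour c p)
      (listSum≡0 (oldColourClash v x) (listSum≡0 (λ x → listSum (pairs X) (oldColourClash v x)) noOld x∈X) p∈)

    newColour : ∀ {x y} → (x , y) ∈ pairs X → edgeColour c v x ≢ edgeColour c v y
    newColour {x} {y} xy∈ = 𝟙≡0⇒¬ (edgeColour c v x ≟ edgeColour c v y) (listSum≡0 (newColourClash v) noNew xy∈)

  ∑-repeats : ∀ X → ∑[ v < n ] repeats X v ≡ length X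
  ∑-repeats X = begin
    ∑[ v < n ] ∑[ x ← X ] 𝟙 (v ≟ x)  ≡⟨ ∑-listSum-comm X (λ v x → 𝟙 (v ≟ x)) ⟩
    ∑[ x ← X ] ∑[ v < n ] 𝟙 (v ≟ x)  ≡⟨ listSum-cong X ∑-𝟙[v≟w]≡1 ⟩
    ∑[ x ← X ] 1                     ≡⟨ trans (listSum-const X 1) (*-identityʳ _) ⟩
    length X                         ∎
    where open ≡-Reasoning

  ∑-oldColourClashes : ∀ X → ∑[ v < n ] oldColourClashes X v ≤ length X * (length (pairs X) * S)
  ∑-oldColourClashes X = begin
    ∑[ v < n ] ∑[ x ← X ] listSum (pairs X) (oldColourClash v x)
      ≡⟨ ∑-listSum-comm X (λ v x → listSum (pairs X) (oldColourClash v x)) ⟩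
    ∑[ x ← X ] ∑[ v < n ] listSum (pairs X) (oldColourClash v x)
      ≡⟨ listSum-cong X (λ x → ∑-listSum-comm (pairs X) (λ v → oldColourClash v x)) ⟩
    ∑[ x ← X ] ∑[ p ← pairs X ] ∑[ v < n ] oldColourClash v x p
      ≤⟨ listSum-mono-≤ X (λ x → listSum-mono-≤ (pairs X) (λ p → colourDegreeᵀ≤S x (pairColour c p))) ⟩
    ∑[ x ← X ] ∑[ p ← pairs X ] S
      ≡⟨ trans (listSum-cong X (λ _ → listSum-const (pairs X) S)) (listSum-const X (length (pairs X) * S)) ⟩
    length X * (length (pairs X) * S)
      ∎
    where open ≤-Reasoning

  ∑-newColourClashes : ∀ X → ∑[ v < n ] newColourClashes X v ≡ Φ X
  ∑-newColourClashes X = ∑-listSum-comm (pairs X) newColourClash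

  ∑-codegreeTo : ∀ X → ∑[ v < n ] codegreeTo X v ≤ n * (length X * S)
  ∑-codegreeTo X = begin
    ∑[ v < n ] ∑[ x ← X ] codegree v x
      ≡⟨ ∑-listSum-comm X codegree ⟩
    ∑[ x ← X ] ∑[ v < n ] ∑[ w < n ] 𝟙 (edgeColour c w v ≟ edgeColour c w x)
      ≡⟨ listSum-cong X (λ x → ∑-comm (λ v w → 𝟙 (edgeColour c w v ≟ edgeColour c w x))) ⟩
    ∑[ x ← X ] ∑[ w < n ] colourDegree c w (edgeColour c w x)
      ≤⟨ listSum-mono-≤ X (λ x → ∑-mono-≤ (λ w → colourDegree≤S w (edgeColour c w x))) ⟩
    ∑[ x ← X ] ∑[ w < n ] S
      ≡⟨ trans (listSum-cong X (λ _ → ∑-const n S)) (listSum-const X (n * S)) ⟩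
    length X * (n * S)
      ≡⟨ x∙yz≈y∙xz (length X) n S ⟩
    n * (length X * S)
      ∎
    where open ≤-Reasoning

  ∑-conflicts : ∀ X → let j = length X in ∑[ v < n ] conflicts X v ≤ j + j * ((j C 2) * S) + Φ X
  ∑-conflicts X = begin
    ∑[ v < n ] conflicts X v
      ≡⟨ ∑-distrib-+ (λ v → repeats X v + oldColourClashes X v) (newColourClashes X) ⟩
    ∑[ v < n ] (repeats X v + oldColourClashes X v) + ∑ (newColourClashes X)
      ≡⟨ cong₂ _+_ (∑-distrib-+ (repeats X) (oldColourClashes X)) (∑-newColourClashes X) ⟩
    ∑ (repeats X) + ∑ (oldColourClashes X) + Φ X
      ≤⟨ +-monoˡ-≤ (Φ X) (+-mono-≤ (≤-reflexive (∑-repeats X)) (∑-oldColourClashes X)) ⟩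
    length X + length X * (length (pairs X) * S) + Φ X
      ≡⟨ cong (λ l → length X + length X * (l * S) + Φ X) (length-pairs X) ⟩
    length X + length X * ((length X C 2) * S) + Φ X
      ∎
    where open ≤-Reasoning

  extend : ∀ {X} → let j = length X in .{{NonZero n}} → Rainbow c X → Φ X ≤ j * j * S →
    2 * (j + j * ((j C 2) * S) + j * j * S) ≤ n →
    ∃ λ v → Rainbow c (v ∷ X) × Φ (v ∷ X) ≤ suc j * suc j * S
  extend {X} rainbow Φ≤ budget = v , conflicts≡0⇒rainbow-∷ rainbow noConflict , Φ′≤
    where
    j = length X
    2∑conflicts≤n : 2 * ∑ (conflicts X) ≤ n
    2∑conflicts≤n = ≤-trans (*-monoʳ-≤ 2 (≤-trans (∑-conflicts X) (+-monoʳ-≤ (j + j * ((j C 2) * S)) Φ≤))) budget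
    found : ∃ λ v → conflicts X v ≡ 0 × codegreeTo X v ≤ 2 * (j * S)
    found = weighted-pigeonhole (conflicts X) (codegreeTo X) (j * S) 2∑conflicts≤n (∑-codegreeTo X)
    v = proj₁ found
    noConflict = proj₁ (proj₂ found)
    Φ′≤ : Φ (v ∷ X) ≤ suc j * suc j * S
    Φ′≤ = subst (_≤ suc j * suc j * S) (sym (Φ-∷ v X)) (potential-step {j} {S} (proj₂ (proj₂ found)) Φ≤)

  rainbowList : ∀ m → 2 * m + m ^ 3 * S ≤ n → ∃ λ X → length X ≡ m × Rainbow c X
  rainbowList m large = Product.map₂ (Product.map₂ proj₁) (grow m ≤-refl)
    where
    grow : ∀ j → j ≤ m → ∃ λ X → length X ≡ j × Rainbow c X × Φ X ≤ j * j * S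
    grow zero _ = [] , refl , rainbow-[] c , z≤n
    grow (suc j) j<m with grow j (<⇒≤ j<m)
    ... | X , refl , rainbow , Φ≤ =
      Product.map (_∷ X) (refl ,_) (extend rainbow Φ≤ (conflict-budget {C = j C 2} S j<m (2*nC2≤n*n j) large))
      where
      instance
        n≢0 : NonZero n
        n≢0 = >-nonZero (≤-trans (≤-trans (s≤s z≤n) j<m) (≤-trans (m≤m+n m _) (≤-trans (m≤m+n (2 * m) _) large)))

∑-firsts : ∀ k r → r ≤ k → ∑[ i < k ] (if toℕ i <ᵇ r then 1 else 0) ≡ r
∑-firsts zero .zero z≤n = refl
∑-firsts (suc k) zero _ = trans (∑-const k 0) (*-zeroʳ k)
∑-firsts (suc k) (suc r) (s≤s r≤k) = cong suc (∑-firsts k r r≤k)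

balanced : ∀ k .{{_ : NonZero k}} → ℕ → Fin k → ℕ
balanced k T i = T / k + (if toℕ i <ᵇ T % k then 1 else 0)

balanced≤ : ∀ k .{{_ : NonZero k}} T i → balanced k T i ≤ suc (T / k)
balanced≤ k T i with toℕ i <ᵇ T % k
... | true = ≤-reflexive (+-comm (T / k) 1)
... | false = ≤-trans (≤-reflexive (+-identityʳ (T / k))) (n≤1+n (T / k))

total-balanced : ∀ k .{{_ : NonZero k}} T → total (balanced k T) ≡ T
total-balanced k T = begin
  sum (map (balanced k T) (allFin k))                    ≡⟨ sum-map-allFin (balanced k T) ⟩
  ∑[ i < k ] (T / k + (if toℕ i <ᵇ T % k then 1 else 0))  ≡⟨ ∑-distrib-+ (λ (_ : Fin k) → T / k) (λ i → if toℕ i <ᵇ T % k then 1 else 0) ⟩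
  ∑[ i < k ] (T / k) + ∑[ i < k ] (if toℕ i <ᵇ T % k then 1 else 0)  ≡⟨ cong₂ _+_ (∑-const k (T / k)) (∑-firsts k (T % k) (m%n≤n T k)) ⟩
  k * (T / k) + T % k                                     ≡⟨ trans (+-comm (k * (T / k)) (T % k)) (cong (T % k +_) (*-comm k (T / k))) ⟩
  T % k + T / k * k                                       ≡⟨ m≡m%n+[m/n]*n T k ⟨
  T                                                       ∎
  where open ≡-Reasoning

rainbowCopy-of-sparse : ∀ {m n k} (H : Graph m) (c : Colouring n k) q →
  (∀ i → colourCount c i ≤ suc q) → 2 * m + m ^ 3 * (q + 2) ≤ n → ∃ λ φ → IsRainbowCopy H c φ
rainbowCopy-of-sparse {m} H c q sparse large =
  let X , |X|≡m , rainbow = Greedy.rainbowList c (q + 2) colourDegree≤q+2 m large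
  in rainbowCopy c H rainbow |X|≡m
  where
  colourDegree≤q+2 : ∀ w i → colourDegree c w i ≤ q + 2
  colourDegree≤q+2 w i = ≤-trans (colourDegree≤colourCount+1 c w i)
    (≤-trans (+-monoˡ-≤ 1 (sparse i)) (≤-reflexive (sym (+-suc q 1))))

balanced⇒rainbowCopy : ∀ {m n k} .{{_ : NonZero k}} (H : Graph m) (c : Colouring n k) →
  HasDistribution c (balanced k (n C 2)) → 4 * m + 4 * m ^ 3 < n → m ^ 3 * n < k →
  ∃ λ φ → IsRainbowCopy H c φ
balanced⇒rainbowCopy {m} {n} {k} H c hasDistribution 4m+4m³<n m³n<k =
  rainbowCopy-of-sparse H c q sparse (size-bound {m} {m ^ 3} {q} {n} 2m³q≤n (<⇒≤ 4m+4m³<n))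
  where
  q = (n C 2) / k
  sparse : ∀ i → colourCount c i ≤ suc q
  sparse i = subst (_≤ suc q) (sym (hasDistribution i)) (balanced≤ k (n C 2) i)
  instance
    n≢0 : NonZero n
    n≢0 = >-nonZero (≤-trans (s≤s z≤n) 4m+4m³<n)
  2m³q≤n : 2 * (m ^ 3 * q) ≤ n
  2m³q≤n = quotient-bound {m ^ 3} {n} {k} {n C 2} q (m/n*n≤m (n C 2) k) (2*nC2≤n*n n) m³n<k

corollary3p2 : ∀ (m : ℕ) (H : Graph m) → ∃ λ K → ∀ k → K ≤ k →
    ∀ N → GoodThreshold H k N → k ≤ m ^ 3 * N
corollary3p2 m H = suc (m ^ 3 * L) , bound
  where
  L = suc (4 * m + 4 * m ^ 3)
  bound : ∀ k → suc (m ^ 3 * L) ≤ k → ∀ N → GoodThreshold H k N → k ≤ m ^ 3 * N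
  bound k@(suc _) m³L<k N good = ≮⇒≥ λ m³N<k →
    let n = N ⊔ L
        m³n<k = subst (_< k) (sym (*-distribˡ-⊔ (m ^ 3) N L)) (⊔-pres-<m m³N<k m³L<k)
        c , rainbowFree , hasDistribution = good n (m≤m⊔n N L) (balanced k (n C 2)) (total-balanced k (n C 2))
    in rainbowFree (balanced⇒rainbowCopy H c hasDistribution (m≤n⊔m N L) m³n<k)
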